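{- The class $\mathbf{BES}$ of bundle event structures ordered by the sub-BES relation $\trianglelefteq$ is an $\omega$-complete partially ordered set: $\trianglelefteq$ is a partial order and every countable ascending chain $\mathcal{E}_0\trianglelefteq\mathcal{E}_1\trianglelefteq\cdots$ has a least upper bound in $\mathbf{BES}$.
   Context: A bundle event structure (BES) over a set of actions $\Sigma$ is $\mathcal{E}=(E,\#,\mapsto,\lambda,\Phi)$: $E$ a set of events; $\#\subseteq E\times E$ an irreflexive symmetric relation; for $x,y\subseteq E$, $x\#y$ means $e\#f$ for all $e\in x,f\in y$ with $e\neq f$; $\mapsto\subseteq\mathcal{P}(E)\times E$ with $x\mapsto e\Rightarrow x\#x$; $\lambda:E\to\Sigma$ a partial labelling function; $\Phi\subseteq E$ (final events) with $\Phi\#\Phi$. For BES $\mathcal{E},\mathcal{F}$, $\mathcal{E}\trianglelefteq\mathcal{F}$ iff $E\subseteq F$; $\#_\mathcal{E}=\#_\mathcal{F}\cap(E\times E)$; $\mapsto_\mathcal{E}\subseteq\mapsto_\mathcal{F}$; whenever $x\mapsto_\mathcal{F}e$ and $e\in E$ then $x\subseteq E$ and $x\mapsto_\mathcal{E}e$; $\lambda_\mathcal{E}=\lambda_\mathcal{F}|_E$; and $\Phi_\mathcal{E}=\Phi_\mathcal{F}\cap E$. -}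

module Defs where

open import Level using (0ℓ)
open import Data.Nat using (ℕ; suc)
open import Data.Maybe using (Maybe)
open import Data.Product using (_×_; Σ; ∃; _,_)
open import Relation.Binary.PropositionalEquality using (_≡_; _≢_)
open import Relation.Nullary using (¬_)
open import Relation.Unary using (Pred; _∈_; _⊆_)
open import Relation.Binary.Structures using (IsPartialOrder)

EvSet : Set → Set₁
EvSet Ev = Pred Ev 0ℓ

_≐_ : {Ev : Set} → EvSet Ev → EvSet Ev → Set
x ≐ y = (x ⊆ y) × (y ⊆ x)

record BES (Ev Act : Set) : Set₁ where
  field
    E    : EvSet Ev
    _#_  : Ev → Ev → Set
    #-dom   : ∀ {e f} → e # f → (e ∈ E) × (f ∈ E)
    #-irrefl : ∀ {e} → ¬ (e # e)
    #-sym    : ∀ {e f} → e # f → f # e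
    _↦_  : EvSet Ev → Ev → Set
    ↦-resp   : ∀ {x y e} → x ≐ y → x ↦ e → y ↦ e
    ↦-dom    : ∀ {x e} → x ↦ e → (x ⊆ E) × (e ∈ E)
    -- x ↦ e ⇒ x # x  (pairwise conflict of distinct members)
    ↦-conf   : ∀ {x e} → x ↦ e → ∀ {a b} → a ∈ x → b ∈ x → a ≢ b → a # b
    -- partial labelling λ : E ⇀ Act (nothing = unlabelled),
    -- independent of the membership proof
    lab      : (e : Ev) → e ∈ E → Maybe Act
    lab-irr  : ∀ e (p q : e ∈ E) → lab e p ≡ lab e q
    Φ        : EvSet Ev
    Φ⊆E      : Φ ⊆ E
    Φ-conf   : ∀ {a b} → a ∈ Φ → b ∈ Φ → a ≢ b → a # b

open BES

record _⊴_ {Ev Act : Set} (𝓔 𝓕 : BES Ev Act) : Set₁ where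
  field
    ⊴-E    : E 𝓔 ⊆ E 𝓕
    ⊴-#→   : ∀ {e f} → _#_ 𝓔 e f → (_#_ 𝓕 e f × e ∈ E 𝓔 × f ∈ E 𝓔)
    ⊴-#←   : ∀ {e f} → (_#_ 𝓕 e f × e ∈ E 𝓔 × f ∈ E 𝓔) → _#_ 𝓔 e f
    ⊴-↦    : ∀ {x e} → _↦_ 𝓔 x e → _↦_ 𝓕 x e
    ⊴-↦↓   : ∀ {x e} → _↦_ 𝓕 x e → e ∈ E 𝓔 → (x ⊆ E 𝓔) × _↦_ 𝓔 x e
    ⊴-lab  : ∀ e (p : e ∈ E 𝓔) (q : e ∈ E 𝓕) → lab 𝓔 e p ≡ lab 𝓕 e q
    ⊴-Φ→   : ∀ {e} → e ∈ Φ 𝓔 → (e ∈ Φ 𝓕 × e ∈ E 𝓔)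
    ⊴-Φ←   : ∀ {e} → (e ∈ Φ 𝓕 × e ∈ E 𝓔) → e ∈ Φ 𝓔

record _≋_ {Ev Act : Set} (𝓔 𝓕 : BES Ev Act) : Set₁ where
  field
    ≋-E    : E 𝓔 ≐ E 𝓕
    ≋-#→   : ∀ {e f} → _#_ 𝓔 e f → _#_ 𝓕 e f
    ≋-#←   : ∀ {e f} → _#_ 𝓕 e f → _#_ 𝓔 e f
    ≋-↦→   : ∀ {x e} → _↦_ 𝓔 x e → _↦_ 𝓕 x e
    ≋-↦←   : ∀ {x e} → _↦_ 𝓕 x e → _↦_ 𝓔 x e
    ≋-lab  : ∀ e (p : e ∈ E 𝓔) (q : e ∈ E 𝓕) → lab 𝓔 e p ≡ lab 𝓕 e q
    ≋-Φ    : Φ 𝓔 ≐ Φ 𝓕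

IsChain : {Ev Act : Set} → (ℕ → BES Ev Act) → Set₁
IsChain C = ∀ n → C n ⊴ C (suc n)

IsLub : {Ev Act : Set} → (ℕ → BES Ev Act) → BES Ev Act → Set₁
IsLub {Ev} {Act} C 𝓤 =
  (∀ n → C n ⊴ 𝓤) × (∀ (𝓥 : BES Ev Act) → (∀ n → C n ⊴ 𝓥) → 𝓤 ⊴ 𝓥)

IsωCPO : (Ev Act : Set) → Set₁
IsωCPO Ev Act =
  IsPartialOrder (_≋_ {Ev} {Act}) _⊴_
  × (∀ (C : ℕ → BES Ev Act) → IsChain C → Σ (BES Ev Act) (IsLub C))

module Submission where

open import Defs
open import Data.Nat using (ℕ; _≤_; _≤‴_; ≤‴-refl; ≤‴-step; _⊔_)
open import Data.Nat.Properties using (≤⇒≤‴; m≤m⊔n; m≤n⊔m)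
open import Data.Product using (Σ; _×_; _,_; proj₁; proj₂)
open import Relation.Binary.PropositionalEquality using (_≡_; sym; trans)
open import Relation.Unary using (_∈_; _⊆_)
open import Relation.Binary.Structures using (IsPartialOrder; IsEquivalence)

-- The lub of a chain is its union: an event, conflict, bundle or final event belongs to it
-- iff it belongs to some member. That the union is again a BES, and a sub-BES of every
-- upper bound, rests on one observation: any two members of a chain lie below a common
-- member, and two sub-BESs of a common BES agree on the conflicts, bundles, labels and
-- final events among the events of either.

open BES
open _⊴_
open _≋_

module _ {Ev Act : Set} where

  ⊴-refl : (A : BES Ev Act) → A ⊴ A
  ⊴-refl A = record
    { ⊴-E   = λ p → p
    ; ⊴-#→  = λ h → h , #-dom A h
    ; ⊴-#←  = proj₁
    ; ⊴-↦   = λ h → h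
    ; ⊴-↦↓  = λ h _ → proj₁ (↦-dom A h) , h
    ; ⊴-lab = lab-irr A
    ; ⊴-Φ→  = λ p → p , Φ⊆E A p
    ; ⊴-Φ←  = proj₁
    }

  ⊴-trans : {A B C : BES Ev Act} → A ⊴ B → B ⊴ C → A ⊴ C
  ⊴-trans ab bc = record
    { ⊴-E   = λ p → ⊴-E bc (⊴-E ab p)
    ; ⊴-#→  = λ h → let (h′ , e∈A , f∈A) = ⊴-#→ ab h in proj₁ (⊴-#→ bc h′) , e∈A , f∈A
    ; ⊴-#←  = λ { (h , e∈A , f∈A) →
                  ⊴-#← ab (⊴-#← bc (h , ⊴-E ab e∈A , ⊴-E ab f∈A) , e∈A , f∈A) }
    ; ⊴-↦   = λ h → ⊴-↦ bc (⊴-↦ ab h)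
    ; ⊴-↦↓  = λ h e∈A → ⊴-↦↓ ab (proj₂ (⊴-↦↓ bc h (⊴-E ab e∈A))) e∈A
    ; ⊴-lab = λ e p q → trans (⊴-lab ab e p (⊴-E ab p)) (⊴-lab bc e (⊴-E ab p) q)
    ; ⊴-Φ→  = λ p → let (p′ , e∈A) = ⊴-Φ→ ab p in proj₁ (⊴-Φ→ bc p′) , e∈A
    ; ⊴-Φ←  = λ { (p , e∈A) → ⊴-Φ← ab (⊴-Φ← bc (p , ⊴-E ab e∈A) , e∈A) }
    }

  ≋-isEquivalence : IsEquivalence (_≋_ {Ev} {Act})
  ≋-isEquivalence = record
    { refl  = λ {A} → record
        { ≋-E = (λ p → p) , (λ p → p) ; ≋-#→ = λ h → h ; ≋-#← = λ h → h
        ; ≋-↦→ = λ h → h ; ≋-↦← = λ h → h ; ≋-lab = lab-irr A ; ≋-Φ = (λ p → p) , (λ p → p) }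
    ; sym   = λ q → record
        { ≋-E = proj₂ (≋-E q) , proj₁ (≋-E q) ; ≋-#→ = ≋-#← q ; ≋-#← = ≋-#→ q
        ; ≋-↦→ = ≋-↦← q ; ≋-↦← = ≋-↦→ q ; ≋-lab = λ e p r → sym (≋-lab q e r p)
        ; ≋-Φ = proj₂ (≋-Φ q) , proj₁ (≋-Φ q) }
    ; trans = λ q r → record
        { ≋-E = (λ p → proj₁ (≋-E r) (proj₁ (≋-E q) p)) , (λ p → proj₂ (≋-E q) (proj₂ (≋-E r) p))
        ; ≋-#→ = λ h → ≋-#→ r (≋-#→ q h) ; ≋-#← = λ h → ≋-#← q (≋-#← r h)
        ; ≋-↦→ = λ h → ≋-↦→ r (≋-↦→ q h) ; ≋-↦← = λ h → ≋-↦← q (≋-↦← r h)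
        ; ≋-lab = λ e p s → trans (≋-lab q e p (proj₁ (≋-E q) p)) (≋-lab r e (proj₁ (≋-E q) p) s)
        ; ≋-Φ = (λ p → proj₁ (≋-Φ r) (proj₁ (≋-Φ q) p)) , (λ p → proj₂ (≋-Φ q) (proj₂ (≋-Φ r) p)) }
    }

  ≋⇒⊴ : {A B : BES Ev Act} → A ≋ B → A ⊴ B
  ≋⇒⊴ {A} {B} q = record
    { ⊴-E   = proj₁ (≋-E q)
    ; ⊴-#→  = λ h → ≋-#→ q h , #-dom A h
    ; ⊴-#←  = λ t → ≋-#← q (proj₁ t)
    ; ⊴-↦   = ≋-↦→ q
    ; ⊴-↦↓  = λ h _ → (λ p → proj₂ (≋-E q) (proj₁ (↦-dom B h) p)) , ≋-↦← q h
    ; ⊴-lab = ≋-lab q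
    ; ⊴-Φ→  = λ p → proj₁ (≋-Φ q) p , Φ⊆E A p
    ; ⊴-Φ←  = λ t → proj₂ (≋-Φ q) (proj₁ t)
    }

  ⊴-antisym : {A B : BES Ev Act} → A ⊴ B → B ⊴ A → A ≋ B
  ⊴-antisym ab ba = record
    { ≋-E   = ⊴-E ab , ⊴-E ba
    ; ≋-#→  = λ h → proj₁ (⊴-#→ ab h)
    ; ≋-#←  = λ h → proj₁ (⊴-#→ ba h)
    ; ≋-↦→  = ⊴-↦ ab
    ; ≋-↦←  = ⊴-↦ ba
    ; ≋-lab = ⊴-lab ab
    ; ≋-Φ   = (λ p → proj₁ (⊴-Φ→ ab p)) , (λ p → proj₁ (⊴-Φ→ ba p))
    }

  ⊴-isPartialOrder : IsPartialOrder (_≋_ {Ev} {Act}) _⊴_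
  ⊴-isPartialOrder = record
    { isPreorder = record
        { isEquivalence = ≋-isEquivalence
        ; reflexive     = ≋⇒⊴
        ; trans         = ⊴-trans
        }
    ; antisym = ⊴-antisym
    }

  module _ {A B W : BES Ev Act} (A⊴W : A ⊴ W) (B⊴W : B ⊴ W) where

    #-transfer : ∀ {e f} → _#_ B e f → e ∈ E A → f ∈ E A → _#_ A e f
    #-transfer h e∈A f∈A = ⊴-#← A⊴W (proj₁ (⊴-#→ B⊴W h) , e∈A , f∈A)

    ↦-transfer : ∀ {x e} → _↦_ B x e → e ∈ E A → (x ⊆ E A) × _↦_ A x e
    ↦-transfer h e∈A = ⊴-↦↓ A⊴W (⊴-↦ B⊴W h) e∈A

    Φ-transfer : ∀ {e} → e ∈ Φ B → e ∈ E A → e ∈ Φ A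
    Φ-transfer p e∈A = ⊴-Φ← A⊴W (proj₁ (⊴-Φ→ B⊴W p) , e∈A)

    lab-transfer : ∀ e (p : e ∈ E A) (q : e ∈ E B) → lab A e p ≡ lab B e q
    lab-transfer e p q = trans (⊴-lab A⊴W e p (⊴-E A⊴W p)) (sym (⊴-lab B⊴W e q (⊴-E A⊴W p)))

  module Chain (C : ℕ → BES Ev Act) (chain : IsChain C) where

    chain-mono‴ : ∀ {m n} → m ≤‴ n → C m ⊴ C n
    chain-mono‴ {m} ≤‴-refl      = ⊴-refl (C m)
    chain-mono‴ {m} (≤‴-step m<n) = ⊴-trans (chain m) (chain-mono‴ m<n)

    chain-mono : ∀ {m n} → m ≤ n → C m ⊴ C n
    chain-mono m≤n = chain-mono‴ (≤⇒≤‴ m≤n)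

    ⊴-⊔ˡ : ∀ m n → C m ⊴ C (m ⊔ n)
    ⊴-⊔ˡ m n = chain-mono (m≤m⊔n m n)

    ⊴-⊔ʳ : ∀ m n → C n ⊴ C (m ⊔ n)
    ⊴-⊔ʳ m n = chain-mono (m≤n⊔m m n)

    ⨆ : BES Ev Act
    ⨆ = record
      { E        = λ e → Σ ℕ λ n → e ∈ E (C n)
      ; _#_      = λ e f → Σ ℕ λ n → _#_ (C n) e f
      ; #-dom    = λ { (n , h) → let (e∈ , f∈) = #-dom (C n) h in (n , e∈) , (n , f∈) }
      ; #-irrefl = λ { (n , h) → #-irrefl (C n) h }
      ; #-sym    = λ { (n , h) → n , #-sym (C n) h }
      ; _↦_      = λ x e → Σ ℕ λ n → _↦_ (C n) x e
      ; ↦-resp   = λ { x≐y (n , h) → n , ↦-resp (C n) x≐y h }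
      ; ↦-dom    = λ { (n , h) → let (x⊆ , e∈) = ↦-dom (C n) h in (λ a∈x → n , x⊆ a∈x) , (n , e∈) }
      ; ↦-conf   = λ { (n , h) a∈x b∈x a≢b → n , ↦-conf (C n) h a∈x b∈x a≢b }
      ; lab      = λ { e (n , p) → lab (C n) e p }
      ; lab-irr  = λ { e (m , p) (n , q) → lab-transfer (⊴-⊔ˡ m n) (⊴-⊔ʳ m n) e p q }
      ; Φ        = λ e → Σ ℕ λ n → e ∈ Φ (C n)
      ; Φ⊆E      = λ { (n , p) → n , Φ⊆E (C n) p }
      ; Φ-conf   = λ { (m , p) (n , q) a≢b →
                     m ⊔ n , Φ-conf (C (m ⊔ n)) (proj₁ (⊴-Φ→ (⊴-⊔ˡ m n) p))
                                                 (proj₁ (⊴-Φ→ (⊴-⊔ʳ m n) q)) a≢b }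
      }

    ⨆-upper : ∀ n → C n ⊴ ⨆
    ⨆-upper n = record
      { ⊴-E   = λ p → n , p
      ; ⊴-#→  = λ h → (n , h) , #-dom (C n) h
      ; ⊴-#←  = λ { ((m , h) , e∈ , f∈) → #-transfer (⊴-⊔ˡ n m) (⊴-⊔ʳ n m) h e∈ f∈ }
      ; ⊴-↦   = λ h → n , h
      ; ⊴-↦↓  = λ { (m , h) e∈ → ↦-transfer (⊴-⊔ˡ n m) (⊴-⊔ʳ n m) h e∈ }
      ; ⊴-lab = λ { e p (m , q) → lab-transfer (⊴-⊔ˡ n m) (⊴-⊔ʳ n m) e p q }
      ; ⊴-Φ→  = λ p → (n , p) , Φ⊆E (C n) p
      ; ⊴-Φ←  = λ { ((m , p) , e∈) → Φ-transfer (⊴-⊔ˡ n m) (⊴-⊔ʳ n m) p e∈ }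
      }

    ⨆-least : (V : BES Ev Act) → (∀ n → C n ⊴ V) → ⨆ ⊴ V
    ⨆-least V C⊴V = record
      { ⊴-E   = λ { (n , p) → ⊴-E (C⊴V n) p }
      ; ⊴-#→  = λ { (n , h) → let (e∈ , f∈) = #-dom (C n) h in proj₁ (⊴-#→ (C⊴V n) h) , (n , e∈) , (n , f∈) }
      ; ⊴-#←  = λ { (h , (m , e∈) , (n , f∈)) →
                  m ⊔ n , ⊴-#← (C⊴V (m ⊔ n)) (h , ⊴-E (⊴-⊔ˡ m n) e∈ , ⊴-E (⊴-⊔ʳ m n) f∈) }
      ; ⊴-↦   = λ { (n , h) → ⊴-↦ (C⊴V n) h }
      ; ⊴-↦↓  = λ { h (n , e∈) → let (x⊆ , h′) = ⊴-↦↓ (C⊴V n) h e∈ in (λ a∈x → n , x⊆ a∈x) , (n , h′) }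
      ; ⊴-lab = λ { e (n , p) q → ⊴-lab (C⊴V n) e p q }
      ; ⊴-Φ→  = λ { (n , p) → proj₁ (⊴-Φ→ (C⊴V n) p) , (n , Φ⊆E (C n) p) }
      ; ⊴-Φ←  = λ { (p , (n , e∈)) → n , ⊴-Φ← (C⊴V n) (p , e∈) }
      }

proposition2 : (Ev Act : Set) → IsωCPO Ev Act
proposition2 Ev Act = ⊴-isPartialOrder , λ C chain → let open Chain C chain in ⨆ , ⨆-upper , ⨆-least
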